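{- Let $G$ and $H$ be finite simple graphs with $i_G$ and $i_H$ isolated vertices, respectively. Then $$\rho_o(G\times H)\geq \rho_o(G^-)\rho_o(H^-)+i_G|V(H)|+i_H|V(G)|-i_Gi_H.$$
   Context: For a graph $G$, $G^-$ denotes the graph obtained from $G$ by removing all isolated vertices. An open packing of $G$ is a set $P\subseteq V(G)$ with $N_G(u)\cap N_G(v)=\emptyset$ for distinct $u,v\in P$ (open neighborhoods), and $\rho_o(G)$ is the maximum size of an open packing. The direct product $G\times H$ has vertex set $V(G)\times V(H)$, with $(g,h)$ adjacent to $(g',h')$ iff $gg'\in E(G)$ and $hh'\in E(H)$. -}

module Defs where

open import Data.Nat using (ℕ; zero; suc; _⊔_; _*_)
open import Data.Bool using (Bool; true; false; T; _∧_; if_then_else_)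
open import Data.Fin using (Fin; remQuot)
open import Data.Fin.Subset using (Subset; _∈_; ∣_∣)
open import Data.Fin.Properties using (any?; all?)
open import Data.Vec using (Vec; []; _∷_)
open import Data.List using (List; []; _∷_; map; _++_; filter; length; foldr; lookup)
open import Data.List.Base using (allFin)
open import Data.Product using (Σ; ∃; _×_; _,_; proj₁; proj₂)
open import Relation.Nullary using (¬_; Dec; yes; no)
open import Relation.Nullary.Decidable using (¬?; ⌊_⌋; _→-dec_; _×-dec_)
open import Data.Fin.Subset.Properties using (_∈?_)
open import Data.Fin.Properties using (_≟_)
import Data.Bool as B
open import Relation.Binary.PropositionalEquality using (_≡_; _≢_; refl; cong₂)

record Graph : Set where
  field
    n      : ℕ
    adj    : Fin n → Fin n → Bool
    adj-sym    : ∀ u v → adj u v ≡ adj v u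
    adj-irrefl : ∀ u → adj u u ≡ false
open Graph public

Adj : (G : Graph) → Fin (n G) → Fin (n G) → Set
Adj G u v = T (adj G u v)

Isolated : (G : Graph) → Fin (n G) → Set
Isolated G v = ¬ (∃ λ w → Adj G v w)

isolated? : (G : Graph) → (v : Fin (n G)) → Dec (Isolated G v)
isolated? G v = ¬? (any? (λ w → B.T? (adj G v w)))

iso : Graph → ℕ
iso G = length (filter (isolated? G) (allFin (n G)))

-- G⁻ : G with all isolated vertices removed (vertices re-indexed by the
-- list of non-isolated vertices in increasing order).
private
  nonIso : (G : Graph) → List (Fin (n G))
  nonIso G = filter (λ v → ¬? (isolated? G v)) (allFin (n G))

minus : Graph → Graph
minus G = record
  { n      = length (nonIso G)
  ; adj    = λ i j → adj G (lookup (nonIso G) i) (lookup (nonIso G) j)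
  ; adj-sym    = λ i j → adj-sym G (lookup (nonIso G) i) (lookup (nonIso G) j)
  ; adj-irrefl = λ i → adj-irrefl G (lookup (nonIso G) i)
  }

-- Direct product G × H on vertex set Fin (n G * n H) ≅ Fin (n G) × Fin (n H)
-- (via remQuot): (g,h) ~ (g',h') iff g ~ g' in G and h ~ h' in H.
private
  ∧-irr : ∀ a b → a ≡ false → a ∧ b ≡ false
  ∧-irr .false b refl = refl

fstV : ∀ {a} b → Fin (a * b) → Fin a
fstV {a} b x = proj₁ (remQuot {a} b x)

sndV : ∀ {a} b → Fin (a * b) → Fin b
sndV {a} b x = proj₂ (remQuot {a} b x)

directProduct : Graph → Graph → Graph
directProduct G H = record
  { n      = n G * n H
  ; adj    = λ x y → adj G (fstV {n G} (n H) x) (fstV {n G} (n H) y)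
                   ∧ adj H (sndV {n G} (n H) x) (sndV {n G} (n H) y)
  ; adj-sym    = λ x y → cong₂ _∧_ (adj-sym G (fstV {n G} (n H) x) (fstV {n G} (n H) y))
                               (adj-sym H (sndV {n G} (n H) x) (sndV {n G} (n H) y))
  ; adj-irrefl = λ x → ∧-irr _ _ (adj-irrefl G (fstV {n G} (n H) x))
  }

IsOpenPacking : (G : Graph) → Subset (n G) → Set
IsOpenPacking G P =
  ∀ u v → u ∈ P → v ∈ P → u ≢ v → ¬ (∃ λ w → Adj G u w × Adj G v w)

allSubsets : (k : ℕ) → List (Subset k)
allSubsets zero    = [] ∷ []
allSubsets (suc k) = map (true ∷_) (allSubsets k) ++ map (false ∷_) (allSubsets k)

isOpenPacking? : (G : Graph) → (P : Subset (n G)) → Dec (IsOpenPacking G P)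
isOpenPacking? G P =
  all? λ u → all? λ v →
    (u ∈? P) →-dec ((v ∈? P) →-dec ((¬? (u ≟ v)) →-dec
      ¬? (any? λ w → B.T? (adj G u w) ×-dec B.T? (adj G v w))))

ρₒ : Graph → ℕ
ρₒ G = foldr (λ P m → (if ⌊ isOpenPacking? G P ⌋ then ∣ P ∣ else 0) ⊔ m) 0
             (allSubsets (n G))

module Submission where

-- Take maximum open packings P of G⁻ and Q of H⁻, viewed as vertex sets of G and H. Let S consist
-- of the pairs (g , h) with g isolated, or h isolated, or (g , h) ∈ P × Q. A pair with a neighbour
-- has both coordinates non-isolated, so it lies in P × Q, and a common neighbour of two such pairs
-- is coordinatewise a common neighbour; hence S is an open packing of G × H. Since P × Q avoids the
-- isolated rows and columns, inclusion–exclusion gives |S| = |P||Q| + i_G|V(H)| + i_H|V(G)| − i_G i_H.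

open import Defs
open import Data.Bool using (Bool; true; false; T; _∧_; _∨_; if_then_else_)
open import Data.Bool.Properties using (T-≡; T-∧)
open import Data.Empty using (⊥-elim)
open import Data.Fin using (Fin; zero; suc; _↑ˡ_; _↑ʳ_; combine)
open import Data.Fin.Properties using (_≟_; any?; remQuot-combine; combine-remQuot)
open import Data.Fin.Subset using (Subset; _∈_; ∣_∣; ⊥)
open import Data.Fin.Subset.Properties using (_∈?_; ∉⊥)
open import Data.List using (List; []; _∷_; filter; length; lookup; tabulate; foldr; allFin; map)
open import Data.List.Membership.Propositional using () renaming (_∈_ to _∈ₗ_)
open import Data.List.Membership.Propositional.Properties
  using (∈-lookup; ∈-filter⁺; ∈-filter⁻; ∈-allFin; ∈-map⁺; ∈-++⁺ˡ; ∈-++⁺ʳ)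
open import Data.List.Relation.Unary.Any using (here; there; index)
open import Data.List.Relation.Unary.Any.Properties using (lookup-index)
open import Data.Nat using (ℕ; zero; suc; _+_; _*_; _∸_; _≤_; _⊔_; z≤n)
open import Data.Nat.Properties
  using ( +-*-semiring; +-assoc; *-comm; ≤-refl; ≤-reflexive; ≤-trans; m≤n+m; +-mono-≤; +-monoˡ-≤
        ; +-monoʳ-≤; *-mono-≤; ∸-monoˡ-≤; m+n∸n≡m; ⊔-sel; m≤m⊔n; m≤n⊔m; module ≤-Reasoning)
open import Algebra.Properties.Semiring.Sum +-*-semiring
  using (sum-syntax; sum-cong-≗; ∑-distrib-+; *-distribˡ-sum; *-distribʳ-sum)
open import Data.Product using (∃; _×_; _,_; proj₁; proj₂)
open import Data.Sum using (_⊎_; inj₁; inj₂)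
import Data.Vec as Vec
open import Data.Vec.Properties using (lookup∘tabulate; []=⇒lookup; lookup⇒[]=)
open import Function.Bundles using (Equivalence)
open import Level using (0ℓ)
open import Relation.Binary.PropositionalEquality
  using (_≡_; refl; sym; trans; cong; cong₂; subst; module ≡-Reasoning)
open import Relation.Nullary using (¬_; Dec; yes; no; does)
open import Relation.Nullary.Decidable using (⌊_⌋; toWitness; fromWitness; ¬?; _×-dec_; decidable-stable)
open import Relation.Unary using (Pred; Decidable)

toℕ : Bool → ℕ
toℕ true  = 1
toℕ false = 0

toℕ-mono : ∀ {b c} → (T b → T c) → toℕ b ≤ toℕ c
toℕ-mono {false}         _   = z≤n
toℕ-mono {true}  {true}  _   = ≤-refl
toℕ-mono {true}  {false} b⇒c = ⊥-elim (b⇒c _)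

T-does⇒ : ∀ {P : Set} (P? : Dec P) → T (does P?) → P
T-does⇒ (yes p) _ = p

T-∨∨∧⇒ : ∀ {x y z w} → T (x ∨ y ∨ z ∧ w) → ¬ T x → ¬ T y → T z × T w
T-∨∨∧⇒ {true}          _ ¬x _  = ⊥-elim (¬x _)
T-∨∨∧⇒ {false} {true}  _ _  ¬y = ⊥-elim (¬y _)
T-∨∨∧⇒ {false} {false} t _  _  = Equivalence.to T-∧ t

-- Written with unit factors so that every term is a function of x, z times a function of y, w.
toℕ-∨∨∧ : ∀ x y z w → (T z → ¬ T x) → (T w → ¬ T y) →
  toℕ (x ∨ y ∨ z ∧ w) + toℕ x * toℕ y ≡ toℕ z * toℕ w + toℕ x * 1 + 1 * toℕ y
toℕ-∨∨∧ true  _     true  _     z⇒¬x _    = ⊥-elim (z⇒¬x _ _)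
toℕ-∨∨∧ _     true  _     true  _    w⇒¬y = ⊥-elim (w⇒¬y _ _)
toℕ-∨∨∧ true  true  false false _ _ = refl
toℕ-∨∨∧ true  false false true  _ _ = refl
toℕ-∨∨∧ true  false false false _ _ = refl
toℕ-∨∨∧ false true  true  false _ _ = refl
toℕ-∨∨∧ false true  false false _ _ = refl
toℕ-∨∨∧ false false true  true  _ _ = refl
toℕ-∨∨∧ false false true  false _ _ = refl
toℕ-∨∨∧ false false false true  _ _ = refl
toℕ-∨∨∧ false false false false _ _ = refl

∈-tabulate⇒T : ∀ {n} {f : Fin n → Bool} {i} → i ∈ Vec.tabulate f → T (f i)
∈-tabulate⇒T {f = f} {i} i∈ = Equivalence.from T-≡ (trans (sym (lookup∘tabulate f i)) ([]=⇒lookup i∈))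

T-lookup⇒∈ : ∀ {n} {P : Subset n} {i} → T (Vec.lookup P i) → i ∈ P
T-lookup⇒∈ {P = P} {i} t = lookup⇒[]= i P (Equivalence.to T-≡ t)

∑-mono-≤ : ∀ {n} {f g : Fin n → ℕ} → (∀ i → f i ≤ g i) → ∑[ i < n ] f i ≤ ∑[ i < n ] g i
∑-mono-≤ {zero}  f≤g = z≤n
∑-mono-≤ {suc n} f≤g = +-mono-≤ (f≤g zero) (∑-mono-≤ (λ i → f≤g (suc i)))

∑-one : ∀ n → ∑[ i < n ] 1 ≡ n
∑-one zero    = refl
∑-one (suc n) = cong suc (∑-one n)

∑-↑ : ∀ m n (f : Fin (m + n) → ℕ) →
  ∑[ k < m + n ] f k ≡ ∑[ i < m ] f (i ↑ˡ n) + ∑[ j < n ] f (m ↑ʳ j)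
∑-↑ zero    n f = refl
∑-↑ (suc m) n f = trans (cong (f zero +_) (∑-↑ m n (λ k → f (suc k)))) (sym (+-assoc (f zero) _ _))

∑-combine : ∀ m n (f : Fin (m * n) → ℕ) →
  ∑[ k < m * n ] f k ≡ ∑[ i < m ] ∑[ j < n ] f (combine i j)
∑-combine zero    n f = refl
∑-combine (suc m) n f =
  trans (∑-↑ n (m * n) f) (cong (∑[ j < n ] f (j ↑ˡ (m * n)) +_) (∑-combine m n (λ k → f (n ↑ʳ k))))

∑-remQuot : ∀ m n (f : Fin m → Fin n → ℕ) →
  ∑[ k < m * n ] f (fstV {m} n k) (sndV {m} n k) ≡ ∑[ i < m ] ∑[ j < n ] f i j
∑-remQuot m n f = trans (∑-combine m n (λ k → f (fstV {m} n k) (sndV {m} n k)))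
  (sum-cong-≗ λ i → sum-cong-≗ λ j → cong (λ (p : Fin m × Fin n) → f (proj₁ p) (proj₂ p)) (remQuot-combine i j))

∑∑-distrib-+ : ∀ {m n} (f g : Fin m → Fin n → ℕ) →
  ∑[ i < m ] ∑[ j < n ] (f i j + g i j) ≡ ∑[ i < m ] ∑[ j < n ] f i j + ∑[ i < m ] ∑[ j < n ] g i j
∑∑-distrib-+ {m} {n} f g =
  trans (sum-cong-≗ λ i → ∑-distrib-+ (f i) (g i)) (∑-distrib-+ (λ i → ∑[ j < n ] f i j) (λ i → ∑[ j < n ] g i j))

∑∑-separable : ∀ {m n} (f : Fin m → ℕ) (g : Fin n → ℕ) →
  ∑[ i < m ] ∑[ j < n ] (f i * g j) ≡ ∑[ i < m ] f i * ∑[ j < n ] g j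
∑∑-separable f g = sym (trans (*-distribʳ-sum _ f) (sum-cong-≗ λ i → *-distribˡ-sum (f i) g))

∑∑-inclusion-exclusion : ∀ {m n} (F : Fin m → Fin n → ℕ) (x z : Fin m → ℕ) (y w : Fin n → ℕ) →
  (∀ i j → F i j + x i * y j ≡ z i * w j + x i * 1 + 1 * y j) →
  ∑[ i < m ] ∑[ j < n ] F i j + ∑[ i < m ] x i * ∑[ j < n ] y j
    ≡ ∑[ i < m ] z i * ∑[ j < n ] w j + ∑[ i < m ] x i * n + m * ∑[ j < n ] y j
∑∑-inclusion-exclusion {m} {n} F x z y w pointwise = begin
  ∑∑ F + ∑[ i < m ] x i * ∑[ j < n ] y j
    ≡⟨ cong (∑∑ F +_) (∑∑-separable x y) ⟨
  ∑∑ F + ∑∑ (λ i j → x i * y j)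
    ≡⟨ ∑∑-distrib-+ F (λ i j → x i * y j) ⟨
  ∑∑ (λ i j → F i j + x i * y j)
    ≡⟨ sum-cong-≗ (λ i → sum-cong-≗ (pointwise i)) ⟩
  ∑∑ (λ i j → z i * w j + x i * 1 + 1 * y j)
    ≡⟨ trans (∑∑-distrib-+ (λ i j → z i * w j + x i * 1) (λ _ j → 1 * y j))
             (cong (_+ ∑∑ (λ _ j → 1 * y j)) (∑∑-distrib-+ (λ i j → z i * w j) (λ i _ → x i * 1))) ⟩
  ∑∑ (λ i j → z i * w j) + ∑∑ (λ i _ → x i * 1) + ∑∑ (λ _ j → 1 * y j)
    ≡⟨ cong₂ _+_ (cong₂ _+_ (∑∑-separable z w) (∑∑-separable {m} {n} x (λ _ → 1))) (∑∑-separable {m} {n} (λ _ → 1) y) ⟩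
  ∑[ i < m ] z i * ∑[ j < n ] w j + ∑[ i < m ] x i * ∑[ j < n ] 1 + ∑[ i < m ] 1 * ∑[ j < n ] y j
    ≡⟨ cong₂ _+_ (cong (∑[ i < m ] z i * ∑[ j < n ] w j +_) (cong (∑[ i < m ] x i *_) (∑-one n)))
                 (cong (_* ∑[ j < n ] y j) (∑-one m)) ⟩
  ∑[ i < m ] z i * ∑[ j < n ] w j + ∑[ i < m ] x i * n + m * ∑[ j < n ] y j ∎
  where
  open ≡-Reasoning
  ∑∑ : (Fin m → Fin n → ℕ) → ℕ
  ∑∑ f = ∑[ i < m ] ∑[ j < n ] f i j

∣∣-as-∑ : ∀ {n} (P : Subset n) → ∣ P ∣ ≡ ∑[ i < n ] toℕ (Vec.lookup P i)
∣∣-as-∑ Vec.[]          = refl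
∣∣-as-∑ (true Vec.∷ P)  = cong suc (∣∣-as-∑ P)
∣∣-as-∑ (false Vec.∷ P) = ∣∣-as-∑ P

∣tabulate∣ : ∀ {n} (f : Fin n → Bool) → ∣ Vec.tabulate f ∣ ≡ ∑[ i < n ] toℕ (f i)
∣tabulate∣ f = trans (∣∣-as-∑ (Vec.tabulate f)) (sum-cong-≗ λ i → cong toℕ (lookup∘tabulate f i))

module _ {A : Set} {P : Pred A 0ℓ} (P? : Decidable P) where

  length-filter-tabulate : ∀ {n} (f : Fin n → A) →
    length (filter P? (tabulate f)) ≡ ∑[ i < n ] toℕ (does (P? (f i)))
  length-filter-tabulate {zero}  f = refl
  length-filter-tabulate {suc n} f with does (P? (f zero))
  ... | true  = cong suc (length-filter-tabulate (λ i → f (suc i)))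
  ... | false = length-filter-tabulate (λ i → f (suc i))

  ∑-lookup-filter-tabulate-≤ : ∀ {n} (f : Fin n → A) (g : A → ℕ) →
    let xs = filter P? (tabulate f) in
    ∑[ i < length xs ] g (lookup xs i) ≤ ∑[ j < n ] g (f j)
  ∑-lookup-filter-tabulate-≤ {zero}  f g = z≤n
  ∑-lookup-filter-tabulate-≤ {suc n} f g with does (P? (f zero))
  ... | true  = +-monoʳ-≤ (g (f zero)) (∑-lookup-filter-tabulate-≤ (λ i → f (suc i)) g)
  ... | false = ≤-trans (∑-lookup-filter-tabulate-≤ (λ i → f (suc i)) g) (m≤n+m _ (g (f zero)))

module _ {A : Set} (f : A → ℕ) where

  maxOver : List A → ℕ
  maxOver = foldr (λ x m → f x ⊔ m) 0

  maxOver-upper : ∀ {x xs} → x ∈ₗ xs → f x ≤ maxOver xs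
  maxOver-upper {xs = y ∷ ys} (here refl) = m≤m⊔n (f y) (maxOver ys)
  maxOver-upper {xs = y ∷ ys} (there x∈) = ≤-trans (maxOver-upper x∈) (m≤n⊔m (f y) (maxOver ys))

  maxOver-attained : ∀ xs → maxOver xs ≡ 0 ⊎ ∃ λ x → maxOver xs ≡ f x
  maxOver-attained []       = inj₁ refl
  maxOver-attained (y ∷ ys) with ⊔-sel (f y) (maxOver ys)
  ... | inj₁ e = inj₂ (y , e)
  ... | inj₂ e with maxOver-attained ys
  ...   | inj₁ e′       = inj₁ (trans e e′)
  ...   | inj₂ (x , e′) = inj₂ (x , trans e e′)

∈-allSubsets : ∀ k (P : Subset k) → P ∈ₗ allSubsets k
∈-allSubsets zero    Vec.[]          = here refl
∈-allSubsets (suc k) (true Vec.∷ P)  = ∈-++⁺ˡ (∈-map⁺ (true Vec.∷_) (∈-allSubsets k P))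
∈-allSubsets (suc k) (false Vec.∷ P) =
  ∈-++⁺ʳ (map (true Vec.∷_) (allSubsets k)) (∈-map⁺ (false Vec.∷_) (∈-allSubsets k P))

fstV-sndV-injective : ∀ {m} n {x y : Fin (m * n)} →
  fstV {m} n x ≡ fstV {m} n y → sndV {m} n x ≡ sndV {m} n y → x ≡ y
fstV-sndV-injective {m} n {x} {y} fst≡ snd≡ =
  trans (sym (combine-remQuot {m} n x)) (trans (cong₂ combine fst≡ snd≡) (combine-remQuot {m} n y))

Adj-sym : (G : Graph) {u v : Fin (n G)} → Adj G u v → Adj G v u
Adj-sym G {u} {v} = subst T (adj-sym G u v)

adjacent⇒¬Isolated : (G : Graph) {u v : Fin (n G)} → Adj G u v → ¬ Isolated G u
adjacent⇒¬Isolated G {v = v} uv u-iso = u-iso (v , uv)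

-- does rather than ⌊_⌋, so that sums of it match the filter defining iso.
isolatedᵇ : (G : Graph) → Fin (n G) → Bool
isolatedᵇ G v = does (isolated? G v)

adjacent⇒¬isolatedᵇ : (G : Graph) {u v : Fin (n G)} → Adj G u v → ¬ T (isolatedᵇ G u)
adjacent⇒¬isolatedᵇ G {u} uv t = adjacent⇒¬Isolated G uv (T-does⇒ (isolated? G u) t)

iso-as-∑ : (G : Graph) → iso G ≡ ∑[ v < n G ] toℕ (isolatedᵇ G v)
iso-as-∑ G = length-filter-tabulate (isolated? G) (λ v → v)

⊥-isOpenPacking : (G : Graph) → IsOpenPacking G ⊥
⊥-isOpenPacking G u v u∈ _ _ _ = ∉⊥ u∈

isOpenPacking⇒≡ : (G : Graph) {P : Subset (n G)} → IsOpenPacking G P →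
  ∀ {u v w} → u ∈ P → v ∈ P → Adj G u w → Adj G v w → u ≡ v
isOpenPacking⇒≡ G pk {u} {v} {w} u∈ v∈ uw vw =
  decidable-stable (u ≟ v) (λ u≢v → pk u v u∈ v∈ u≢v (w , uw , vw))

packingScore : (G : Graph) → Subset (n G) → ℕ
packingScore G P = if ⌊ isOpenPacking? G P ⌋ then ∣ P ∣ else 0

ρₒ-upper : (G : Graph) {P : Subset (n G)} → IsOpenPacking G P → ∣ P ∣ ≤ ρₒ G
ρₒ-upper G {P} pk =
  ≤-trans (score-≥ (isOpenPacking? G P)) (maxOver-upper (packingScore G) (∈-allSubsets (n G) P))
  where
  score-≥ : (d : Dec (IsOpenPacking G P)) → ∣ P ∣ ≤ (if ⌊ d ⌋ then ∣ P ∣ else 0)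
  score-≥ (yes _)  = ≤-refl
  score-≥ (no ¬pk) = ⊥-elim (¬pk pk)

maximumOpenPacking : (G : Graph) → ∃ λ P → IsOpenPacking G P × ρₒ G ≤ ∣ P ∣
maximumOpenPacking G with maxOver-attained (packingScore G) (allSubsets (n G))
... | inj₁ ρ≡0 = ⊥ , ⊥-isOpenPacking G , ≤-trans (≤-reflexive ρ≡0) z≤n
... | inj₂ (P , ρ≡score) with isOpenPacking? G P
...   | yes pk = P , pk , ≤-reflexive ρ≡score
...   | no _   = ⊥ , ⊥-isOpenPacking G , ≤-trans (≤-reflexive ρ≡score) z≤n

module _ (G : Graph) where

  -- Definitionally the list of vertices by which minus G is indexed.
  nonIsolatedVertices : List (Fin (n G))
  nonIsolatedVertices = filter (λ v → ¬? (isolated? G v)) (allFin (n G))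

  embed : Fin (n (minus G)) → Fin (n G)
  embed = lookup nonIsolatedVertices

  embed-nonIsolated : ∀ i → ¬ Isolated G (embed i)
  embed-nonIsolated i = proj₂ (∈-filter⁻ (λ v → ¬? (isolated? G v)) {xs = allFin (n G)} (∈-lookup i))

  nonIsolated⇒embed : ∀ {v} → ¬ Isolated G v → ∃ λ i → embed i ≡ v
  nonIsolated⇒embed {v} ¬v-iso = index v∈ , sym (lookup-index v∈)
    where
    v∈ : v ∈ₗ nonIsolatedVertices
    v∈ = ∈-filter⁺ (λ v → ¬? (isolated? G v)) (∈-allFin v) ¬v-iso

  inImage : Subset (n (minus G)) → Fin (n G) → Bool
  inImage P v = ⌊ any? (λ i → (i ∈? P) ×-dec (embed i ≟ v)) ⌋

  lift : Subset (n (minus G)) → Subset (n G)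
  lift P = Vec.tabulate (inImage P)

  ∈lift⇒ : ∀ {P v} → v ∈ lift P → ∃ λ i → i ∈ P × embed i ≡ v
  ∈lift⇒ v∈ = toWitness (∈-tabulate⇒T v∈)

  lift-nonIsolated : ∀ {P v} → v ∈ lift P → ¬ Isolated G v
  lift-nonIsolated v∈ with ∈lift⇒ v∈
  ... | i , _ , refl = embed-nonIsolated i

  lift-isOpenPacking : ∀ {P} → IsOpenPacking (minus G) P → IsOpenPacking G (lift P)
  lift-isOpenPacking pk u v u∈ v∈ u≢v (w , uw , vw)
    with i , i∈ , refl ← ∈lift⇒ u∈
       | j , j∈ , refl ← ∈lift⇒ v∈
       | k , refl ← nonIsolated⇒embed (adjacent⇒¬Isolated G (Adj-sym G uw))
    = pk i j i∈ j∈ (λ i≡j → u≢v (cong embed i≡j)) (k , uw , vw)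

  ∣∣≤∣lift∣ : ∀ P → ∣ P ∣ ≤ ∣ lift P ∣
  ∣∣≤∣lift∣ P = begin
    ∣ P ∣                                          ≡⟨ ∣∣-as-∑ P ⟩
    ∑[ i < n (minus G) ] toℕ (Vec.lookup P i)       ≤⟨ ∑-mono-≤ (λ i → toℕ-mono (embed-∈lift i)) ⟩
    ∑[ i < n (minus G) ] toℕ (inImage P (embed i))
      ≤⟨ ∑-lookup-filter-tabulate-≤ (λ v → ¬? (isolated? G v)) (λ v → v) (λ v → toℕ (inImage P v)) ⟩
    ∑[ v < n G ] toℕ (inImage P v)                 ≡⟨ ∣tabulate∣ (inImage P) ⟨
    ∣ lift P ∣                                     ∎
    where
    open ≤-Reasoning
    embed-∈lift : ∀ i → T (Vec.lookup P i) → T (inImage P (embed i))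
    embed-∈lift i t = fromWitness (i , T-lookup⇒∈ t , refl)

module _ (G H : Graph) (A : Subset (n G)) (B : Subset (n H)) where

  private
    fst : Fin (n G * n H) → Fin (n G)
    fst = fstV {n G} (n H)

    snd : Fin (n G * n H) → Fin (n H)
    snd = sndV {n G} (n H)

  productIndicator : Fin (n G) → Fin (n H) → Bool
  productIndicator g h = isolatedᵇ G g ∨ isolatedᵇ H h ∨ Vec.lookup A g ∧ Vec.lookup B h

  productPacking : Subset (n (directProduct G H))
  productPacking = Vec.tabulate λ x → productIndicator (fst x) (snd x)

  ∈productPacking⇒ : ∀ {x y} → x ∈ productPacking → Adj (directProduct G H) x y → fst x ∈ A × snd x ∈ B
  ∈productPacking⇒ {x} x∈ xy =
    let gg′ , hh′ = Equivalence.to T-∧ xy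
        tA , tB   = T-∨∨∧⇒ (∈-tabulate⇒T {i = x} x∈) (adjacent⇒¬isolatedᵇ G gg′) (adjacent⇒¬isolatedᵇ H hh′)
    in T-lookup⇒∈ tA , T-lookup⇒∈ tB

  productPacking-isOpenPacking : IsOpenPacking G A → IsOpenPacking H B →
    IsOpenPacking (directProduct G H) productPacking
  productPacking-isOpenPacking A-packing B-packing u v u∈ v∈ u≢v (w , uw , vw) =
    let uA , uB = ∈productPacking⇒ u∈ uw
        vA , vB = ∈productPacking⇒ v∈ vw
        uwG , uwH = Equivalence.to T-∧ uw
        vwG , vwH = Equivalence.to T-∧ vw
    in u≢v (fstV-sndV-injective (n H) (isOpenPacking⇒≡ G A-packing uA vA uwG vwG)
                                      (isOpenPacking⇒≡ H B-packing uB vB uwH vwH))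

  productPacking-size : (∀ {g} → g ∈ A → ¬ Isolated G g) → (∀ {h} → h ∈ B → ¬ Isolated H h) →
    ∣ productPacking ∣ + iso G * iso H ≡ ∣ A ∣ * ∣ B ∣ + iso G * n H + iso H * n G
  productPacking-size A-nonIsolated B-nonIsolated = begin
    ∣ productPacking ∣ + iso G * iso H
      ≡⟨ cong₂ _+_ (trans (∣tabulate∣ {n G * n H} _) (∑-remQuot (n G) (n H) F)) (cong₂ _*_ (iso-as-∑ G) (iso-as-∑ H)) ⟩
    ∑[ g < n G ] ∑[ h < n H ] F g h + ∑[ g < n G ] x g * ∑[ h < n H ] y h
      ≡⟨ ∑∑-inclusion-exclusion F x z y w (λ g h → toℕ-∨∨∧ _ _ _ _ (A-disjoint g) (B-disjoint h)) ⟩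
    ∑[ g < n G ] z g * ∑[ h < n H ] w h + ∑[ g < n G ] x g * n H + n G * ∑[ h < n H ] y h
      ≡⟨ cong₂ _+_ (cong₂ _+_ (cong₂ _*_ (∣∣-as-∑ A) (∣∣-as-∑ B)) (cong (_* n H) (iso-as-∑ G)))
                   (cong (n G *_) (iso-as-∑ H)) ⟨
    ∣ A ∣ * ∣ B ∣ + iso G * n H + n G * iso H
      ≡⟨ cong (∣ A ∣ * ∣ B ∣ + iso G * n H +_) (*-comm (n G) (iso H)) ⟩
    ∣ A ∣ * ∣ B ∣ + iso G * n H + iso H * n G ∎
    where
    open ≡-Reasoning
    F : Fin (n G) → Fin (n H) → ℕ
    F g h = toℕ (productIndicator g h)
    x z : Fin (n G) → ℕ
    x g = toℕ (isolatedᵇ G g)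
    z g = toℕ (Vec.lookup A g)
    y w : Fin (n H) → ℕ
    y h = toℕ (isolatedᵇ H h)
    w h = toℕ (Vec.lookup B h)
    A-disjoint : ∀ g → T (Vec.lookup A g) → ¬ T (isolatedᵇ G g)
    A-disjoint g tA t = A-nonIsolated (T-lookup⇒∈ tA) (T-does⇒ (isolated? G g) t)
    B-disjoint : ∀ h → T (Vec.lookup B h) → ¬ T (isolatedᵇ H h)
    B-disjoint h tB t = B-nonIsolated (T-lookup⇒∈ tB) (T-does⇒ (isolated? H h) t)

ρₒ-product-lower : (G H : Graph) {P : Subset (n (minus G))} {Q : Subset (n (minus H))} →
  IsOpenPacking (minus G) P → IsOpenPacking (minus H) Q →
  ∣ P ∣ * ∣ Q ∣ + iso G * n H + iso H * n G ∸ iso G * iso H ≤ ρₒ (directProduct G H)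
ρₒ-product-lower G H {P} {Q} P-packing Q-packing = begin
  ∣ P ∣ * ∣ Q ∣ + iso G * n H + iso H * n G ∸ iso G * iso H
    ≤⟨ ∸-monoˡ-≤ (iso G * iso H) (+-monoˡ-≤ (iso H * n G) (+-monoˡ-≤ (iso G * n H)
         (*-mono-≤ (∣∣≤∣lift∣ G P) (∣∣≤∣lift∣ H Q)))) ⟩
  ∣ A ∣ * ∣ B ∣ + iso G * n H + iso H * n G ∸ iso G * iso H
    ≡⟨ cong (_∸ iso G * iso H) (productPacking-size G H A B (lift-nonIsolated G) (lift-nonIsolated H)) ⟨
  ∣ S ∣ + iso G * iso H ∸ iso G * iso H
    ≡⟨ m+n∸n≡m ∣ S ∣ (iso G * iso H) ⟩
  ∣ S ∣
    ≤⟨ ρₒ-upper (directProduct G H)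
         (productPacking-isOpenPacking G H A B (lift-isOpenPacking G P-packing) (lift-isOpenPacking H Q-packing)) ⟩
  ρₒ (directProduct G H) ∎
  where
  open ≤-Reasoning
  A : Subset (n G)
  A = lift G P
  B : Subset (n H)
  B = lift H Q
  S : Subset (n (directProduct G H))
  S = productPacking G H A B

theorem13 : (G H : Graph) →
    ρₒ (minus G) * ρₒ (minus H) + iso G * n H + iso H * n G ∸ iso G * iso H
      ≤ ρₒ (directProduct G H)
theorem13 G H =
  let P , P-packing , ρ≤∣P∣ = maximumOpenPacking (minus G)
      Q , Q-packing , ρ≤∣Q∣ = maximumOpenPacking (minus H)
  in ≤-trans (∸-monoˡ-≤ (iso G * iso H) (+-monoˡ-≤ (iso H * n G) (+-monoˡ-≤ (iso G * n H) (*-mono-≤ ρ≤∣P∣ ρ≤∣Q∣))))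
             (ρₒ-product-lower G H P-packing Q-packing)
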